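{- Let $(X=C\cup F,d)$ be a finite metric space, $r:C\to\mathbb{R}_{>0}$ and $\mathrm{cov}:C\to\mathbb{R}$. Let $t=\lceil\log_4 r_{\max}\rceil$ where $r_{\max}=\max_{v\in C}r_v$, and for $i=1,\dots,t$ let $L_i=\{v\in C: 4^{i-1}\le r_v<4^i\}$. For each $i$, run Modified Filter on $L_i$ with parameter $\ell=4^i$, obtaining representatives $R_i$ and clusters $\{D(v):v\in R_i\}$. Let $V=\bigcup_{i}R_i$ and let $G_0=(V,E_0)$ be the directed graph in which, for $u\in R_i$, $v\in R_j$ with $i>j$, $(u,v)\in E_0$ iff $d(u,v)\le r_u+r_v+4^j$ (no other edges). Let the contact forest $G$ be obtained from $G_0$ by removing every edge $(u,v)\in E_0$ for which $G_0$ contains a directed path from $u$ to $v$ with at least two edges. Then $G$ is a directed out-forest.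
   Context: Modified Filter with parameter $\ell$, applied to a client set $L$: set $U\leftarrow L$, $R\leftarrow\emptyset$; while $U\neq\emptyset$, pick $v\in U$ maximizing $\mathrm{cov}(v)$ over $U$ (ties arbitrary), add $v$ to $R$, set $D(v)\leftarrow\{u\in U: d(u,v)\le r_u+r_v+\ell\}$ and $U\leftarrow U\setminus D(v)$. A directed out-forest is a directed acyclic graph in which every vertex has in-degree at most $1$ (each weakly connected component is a rooted tree with edges directed away from the root).
   Formalization: The metric d, the radii r and the values of cov are rational rather than real. -}

module Defs where

open import Data.Nat using (ℕ; zero; suc; _∸_) renaming (_≤_ to _≤ℕ_; _<_ to _<ℕ_)
open import Data.Integer using (+_)
open import Data.Rational using (ℚ; 0ℚ; 1ℚ; _+_; _*_; _≤_; _<_; _/_)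
open import Data.Rational.Properties using (_≤?_; _<?_)
open import Data.Fin using (Fin)
open import Data.Fin.Subset using (Subset; _∈_; Empty; inside; outside)
open import Data.Vec using (tabulate; lookup)
open import Data.List using (List; []; _∷_)
open import Data.List.Membership.Propositional using () renaming (_∈_ to _∈ₗ_)
open import Data.Bool using (Bool; true; false; _∧_; not; if_then_else_)
open import Data.Product using (Σ; _×_; ∃)
open import Data.Sum using (_⊎_)
open import Data.Empty using (⊥)
open import Relation.Nullary using (¬_; does)
open import Relation.Binary.PropositionalEquality using (_≡_)
open import Relation.Binary.Construct.Closure.Transitive using (TransClosure)

pow4 : ℕ → ℚ
pow4 zero    = 1ℚ
pow4 (suc k) = (+ 4 / 1) * pow4 k

record IsMetric {n : ℕ} (d : Fin n → Fin n → ℚ) : Set where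
  field
    nonneg   : ∀ x y → 0ℚ ≤ d x y
    zero-iff : ∀ x y → (d x y ≡ 0ℚ → x ≡ y) × (x ≡ y → d x y ≡ 0ℚ)
    symm     : ∀ x y → d x y ≡ d y x
    triangle : ∀ x y z → d x z ≤ d x y + d y z

IsMaxOn : {n : ℕ} → Subset n → (Fin n → ℚ) → ℚ → Set
IsMaxOn C r m = (∃ λ v → v ∈ C × r v ≡ m) × (∀ v → v ∈ C → r v ≤ m)

-- t = ⌈ log₄ m ⌉, for m > 0.  When m ≤ 1 the true value is ≤ 0 and the
-- range i = 1,…,t is empty; we then take t = 0.
IsCeilLog4 : ℚ → ℕ → Set
IsCeilLog4 m t = (m ≤ 1ℚ × t ≡ 0) ⊎ (1 ≤ℕ t × pow4 (t ∸ 1) < m × m ≤ pow4 t)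

module Construction {n : ℕ} (d : Fin n → Fin n → ℚ) (r : Fin n → ℚ) (cov : Fin n → ℚ) where

  level : Subset n → ℕ → Subset n
  level C i = tabulate λ v →
    if lookup C v
    then (if does (pow4 (i ∸ 1) ≤? r v) ∧ does (r v <? pow4 i) then inside else outside)
    else outside

  removeCluster : ℚ → Subset n → Fin n → Subset n
  removeCluster ℓ U v = tabulate λ u →
    if lookup U u
    then (if does (d u v ≤? ((r u + r v) + ℓ)) then outside else inside)
    else outside

  -- FilterRun ℓ U R : some execution of Modified Filter with parameter ℓ
  -- started on the client set U selects the representatives R (in order),
  -- with arbitrary tie-breaking.
  data FilterRun (ℓ : ℚ) : Subset n → List (Fin n) → Set where
    done : ∀ {U} → Empty U → FilterRun ℓ U []
    step : ∀ {U R} (v : Fin n) → v ∈ U → (∀ u → u ∈ U → cov u ≤ cov v) →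
           FilterRun ℓ (removeCluster ℓ U v) R → FilterRun ℓ U (v ∷ R)

  -- Given the representative lists Rs i (meaningful for 1 ≤ i ≤ t):
  module Graph (t : ℕ) (Rs : ℕ → List (Fin n)) where

    InLevel : Fin n → ℕ → Set
    InLevel u i = 1 ≤ℕ i × i ≤ℕ t × u ∈ₗ Rs i

    InV : Fin n → Set
    InV u = ∃ λ i → InLevel u i

    E₀ : Fin n → Fin n → Set
    E₀ u v = Σ ℕ λ i → Σ ℕ λ j → InLevel u i × InLevel v j × j <ℕ i ×
             d u v ≤ (r u + r v) + pow4 j

    E : Fin n → Fin n → Set
    E u v = E₀ u v × ¬ (∃ λ w → E₀ u w × TransClosure E₀ w v)

record IsOutForest {n : ℕ} (V : Fin n → Set) (E : Fin n → Fin n → Set) : Set where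
  field
    edges-in-V : ∀ u v → E u v → V u × V v
    acyclic    : ∀ v → ¬ TransClosure E v v
    in-deg≤1   : ∀ u w v → E u v → E w v → u ≡ w

{-# OPTIONS --safe #-}
-- The radius bands [4^(i-1), 4^i) are disjoint, so every vertex of V has a unique level and
-- every edge of G₀ goes to a strictly lower level; hence G is acyclic.  If u and w are both
-- parents of v ∈ R_j in G₀, the triangle inequality and r_v < 4^j give
-- d(u,w) ≤ r_u + r_w + 4^(j+1).  If u and w lie in the same level i > j, Modified Filter with
-- parameter 4^i would have put one into the cluster of the other unless u = w.  If u lies in
-- a lower level than w, then (w,u) is an edge of G₀ and the path w → u → v removes (w,v) from G.
module Submission where

open import Defs
open import Data.Nat using (ℕ; zero; suc; _∸_; _≤′_; ≤′-reflexive; ≤′-step; s≤s)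
  renaming (_≤_ to _≤ℕ_; _<_ to _<ℕ_)
open import Data.Nat.Properties using (≤⇒≤′; <-cmp)
  renaming (<-irrefl to <ℕ-irrefl; <-trans to <ℕ-trans)
open import Data.Integer using (+_)
open import Data.Rational using (ℚ; 0ℚ; 1ℚ; _+_; _*_; _≤_; _<_; _/_; NonNegative)
open import Data.Rational.Properties
  using (_≤?_; _<?_; ≤-refl; ≤-trans; <-≤-trans; <-irrefl; <⇒≤;
         +-mono-≤; +-monoˡ-≤; +-monoʳ-≤; +-comm; *-identityˡ; *-monoʳ-≤-nonNeg;
         nonNeg*nonNeg⇒nonNeg; module ≤-Reasoning)
open import Data.Rational.Solver using (module +-*-Solver)
open import Data.Fin using (Fin)
open import Data.Fin.Subset using (Subset; Side; inside; outside; _∈_)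
open import Data.Vec using (lookup; tabulate)
open import Data.Vec.Properties using ([]=⇒lookup; lookup⇒[]=; lookup∘tabulate)
open import Data.List using (List)
open import Data.List.Relation.Unary.Any using (here; there)
open import Data.List.Membership.Propositional using () renaming (_∈_ to _∈ₗ_)
open import Data.Bool using (Bool; true; _∧_; if_then_else_)
open import Data.Product using (_×_; _,_; ∃₂; proj₁; proj₂; map₁)
open import Data.Sum using (_⊎_)
open import Data.Empty using (⊥; ⊥-elim)
open import Relation.Nullary using (¬_; Dec; does; yes; no)
open import Relation.Nullary.Decidable using (toWitness)
open import Relation.Binary.Definitions using (tri<; tri≈; tri>)
open import Relation.Binary.PropositionalEquality using (_≡_; refl; sym; trans; cong)
open import Relation.Binary.Construct.Closure.Transitive using (TransClosure; [_]; _∷_)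

pow4-nonNegative : ∀ k → NonNegative (pow4 k)
pow4-nonNegative zero    = _
pow4-nonNegative (suc k) = nonNeg*nonNeg⇒nonNeg (+ 4 / 1) (pow4 k) {{pow4-nonNegative k}}

pow4-≤-suc : ∀ k → pow4 k ≤ pow4 (suc k)
pow4-≤-suc k = begin
  pow4 k              ≡⟨ sym (*-identityˡ (pow4 k)) ⟩
  1ℚ * pow4 k         ≤⟨ *-monoʳ-≤-nonNeg (pow4 k) {{pow4-nonNegative k}}
                                            (toWitness {a? = 1ℚ ≤? + 4 / 1} _) ⟩
  (+ 4 / 1) * pow4 k  ∎
  where open ≤-Reasoning

pow4-mono-≤ : ∀ {m k} → m ≤ℕ k → pow4 m ≤ pow4 k
pow4-mono-≤ m≤k = mono′ (≤⇒≤′ m≤k)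
  where
  mono′ : ∀ {m k} → m ≤′ k → pow4 m ≤ pow4 k
  mono′ (≤′-reflexive refl)        = ≤-refl
  mono′ {k = suc k} (≤′-step m≤′k) = ≤-trans (mono′ m≤′k) (pow4-≤-suc k)

InBand : ℕ → ℚ → Set
InBand i x = pow4 (i ∸ 1) ≤ x × x < pow4 i

InBand-<-disjoint : ∀ {a b x} → a <ℕ b → InBand a x → InBand b x → ⊥
InBand-<-disjoint {b = suc b} (s≤s a≤b) (_ , x<4ᵃ) (4ᵇ≤x , _) =
  <-irrefl refl (<-≤-trans x<4ᵃ (≤-trans (pow4-mono-≤ a≤b) 4ᵇ≤x))

InBand-unique : ∀ {i j x} → InBand i x → InBand j x → i ≡ j
InBand-unique {i} {j} i-band j-band with <-cmp i j
... | tri< i<j _ _ = ⊥-elim (InBand-<-disjoint i<j i-band j-band)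
... | tri≈ _ i≡j _ = i≡j
... | tri> _ _ j<i = ⊥-elim (InBand-<-disjoint j<i j-band i-band)

∈-tabulate⁻ : ∀ {n} {f : Fin n → Side} {u} → u ∈ tabulate f → f u ≡ inside
∈-tabulate⁻ {f = f} {u} u∈ = trans (sym (lookup∘tabulate f u)) ([]=⇒lookup u∈)

module ContactForest {n : ℕ} (d : Fin n → Fin n → ℚ) (metric : IsMetric d)
                     (r : Fin n → ℚ) (cov : Fin n → ℚ) where
  open IsMetric metric
  open Construction d r cov

  Close : ℚ → Fin n → Fin n → Set
  Close ℓ u v = d u v ≤ (r u + r v) + ℓ

  Close-sym : ∀ {ℓ u v} → Close ℓ u v → Close ℓ v u
  Close-sym {ℓ} {u} {v} uv rewrite symm v u | +-comm (r v) (r u) = uv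

  Close-mono : ∀ {ℓ ℓ′ u v} → ℓ ≤ ℓ′ → Close ℓ u v → Close ℓ′ u v
  Close-mono {u = u} {v} ℓ≤ℓ′ uv = ≤-trans uv (+-monoʳ-≤ (r u + r v) ℓ≤ℓ′)

  Close-common-neighbour : ∀ {ℓ u v w} → Close ℓ u v → Close ℓ w v → r v ≤ ℓ →
                           Close ((+ 4 / 1) * ℓ) u w
  Close-common-neighbour {ℓ} {u} {v} {w} uv wv rv≤ℓ = begin
    d u w                                   ≤⟨ triangle u v w ⟩
    d u v + d v w                           ≡⟨ cong (λ x → d u v + x) (symm v w) ⟩
    d u v + d w v                           ≤⟨ +-mono-≤ uv wv ⟩
    ((r u + r v) + ℓ) + ((r w + r v) + ℓ)   ≤⟨ +-mono-≤ (enlarge (r u)) (enlarge (r w)) ⟩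
    ((r u + ℓ) + ℓ) + ((r w + ℓ) + ℓ)       ≡⟨ regroup (r u) (r w) ℓ ⟩
    (r u + r w) + (+ 4 / 1) * ℓ             ∎
    where
    open ≤-Reasoning
    enlarge : ∀ x → (x + r v) + ℓ ≤ (x + ℓ) + ℓ
    enlarge x = +-monoˡ-≤ ℓ (+-monoʳ-≤ x rv≤ℓ)
    regroup : ∀ a b q → ((a + q) + q) + ((b + q) + q) ≡ (a + b) + (+ 4 / 1) * q
    regroup = solve 3 (λ a b q → ((a :+ q) :+ q) :+ ((b :+ q) :+ q) :=
                                 (a :+ b) :+ con (+ 4 / 1) :* q) refl
      where open +-*-Solver

  ∈-removeCluster⁻ : ∀ {ℓ} U v {u} → u ∈ removeCluster ℓ U v → u ∈ U × ¬ Close ℓ u v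
  ∈-removeCluster⁻ {ℓ} U v {u} u∈ =
    map₁ (lookup⇒[]= u U) (kept⁻ (lookup U u) (d u v ≤? (r u + r v) + ℓ) (∈-tabulate⁻ u∈))
    where
    kept⁻ : ∀ {A : Set} (b : Bool) (a? : Dec A) →
      (if b then (if does a? then outside else inside) else outside) ≡ inside →
      b ≡ true × ¬ A
    kept⁻ true (no ¬a) _ = refl , ¬a

  ∈-level⁻ : ∀ {C i u} → u ∈ level C i → InBand i (r u)
  ∈-level⁻ {C} {i} {u} u∈ =
    selected⁻ (lookup C u) (pow4 (i ∸ 1) ≤? r u) (r u <? pow4 i) (∈-tabulate⁻ u∈)
    where
    selected⁻ : ∀ {A B : Set} (b : Bool) (a? : Dec A) (b? : Dec B) →
      (if b then (if does a? ∧ does b? then inside else outside) else outside) ≡ inside →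
      A × B
    selected⁻ true (yes a) (yes b) _ = a , b

  FilterRun-⊆ : ∀ {ℓ U R u} → FilterRun ℓ U R → u ∈ₗ R → u ∈ U
  FilterRun-⊆ (step v v∈U _ _) (here refl) = v∈U
  FilterRun-⊆ {U = U} (step v _ _ run) (there u∈R) =
    proj₁ (∈-removeCluster⁻ U v (FilterRun-⊆ run u∈R))

  FilterRun-close⇒≡ : ∀ {ℓ U R u w} → FilterRun ℓ U R → u ∈ₗ R → w ∈ₗ R → Close ℓ u w → u ≡ w
  FilterRun-close⇒≡ (step v _ _ _) (here refl) (here refl) _ = refl
  FilterRun-close⇒≡ {U = U} (step v _ _ run) (here refl) (there w∈R) vw =
    ⊥-elim (proj₂ (∈-removeCluster⁻ U v (FilterRun-⊆ run w∈R)) (Close-sym vw))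
  FilterRun-close⇒≡ {U = U} (step v _ _ run) (there u∈R) (here refl) uv =
    ⊥-elim (proj₂ (∈-removeCluster⁻ U v (FilterRun-⊆ run u∈R)) uv)
  FilterRun-close⇒≡ (step v _ _ run) (there u∈R) (there w∈R) uw = FilterRun-close⇒≡ run u∈R w∈R uw

  module _ (C : Subset n) (t : ℕ) (Rs : ℕ → List (Fin n))
           (runs : ∀ i → 1 ≤ℕ i → i ≤ℕ t → FilterRun (pow4 i) (level C i) (Rs i)) where
    open Graph t Rs

    InLevel-band : ∀ {u i} → InLevel u i → InBand i (r u)
    InLevel-band {i = i} (1≤i , i≤t , u∈R) = ∈-level⁻ {C} {i} (FilterRun-⊆ (runs _ 1≤i i≤t) u∈R)

    InLevel-unique : ∀ {u i j} → InLevel u i → InLevel u j → i ≡ j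
    InLevel-unique ui uj = InBand-unique (InLevel-band ui) (InLevel-band uj)

    InLevel-close⇒≡ : ∀ {u w i} → InLevel u i → InLevel w i → Close (pow4 i) u w → u ≡ w
    InLevel-close⇒≡ (1≤i , i≤t , u∈R) (_ , _ , w∈R) = FilterRun-close⇒≡ (runs _ 1≤i i≤t) u∈R w∈R

    Descends : Fin n → Fin n → Set
    Descends u v = ∃₂ λ i j → InLevel u i × InLevel v j × j <ℕ i

    E₀⇒Descends : ∀ {u v} → E₀ u v → Descends u v
    E₀⇒Descends (i , j , ui , vj , j<i , _) = i , j , ui , vj , j<i

    Descends-trans : ∀ {u v w} → Descends u v → Descends v w → Descends u w
    Descends-trans (i , j , ui , vj , j<i) (_ , k , vj′ , wk , k<j) with InLevel-unique vj vj′
    ... | refl = i , k , ui , wk , <ℕ-trans k<j j<i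

    Descends-irrefl : ∀ {v} → ¬ Descends v v
    Descends-irrefl (i , j , vi , vj , j<i) with InLevel-unique vi vj
    ... | refl = <ℕ-irrefl refl j<i

    E⁺⇒Descends : ∀ {u v} → TransClosure E u v → Descends u v
    E⁺⇒Descends [ uv ]     = E₀⇒Descends (proj₁ uv)
    E⁺⇒Descends (uv ∷ vw) = Descends-trans (E₀⇒Descends (proj₁ uv)) (E⁺⇒Descends vw)

    co-parents-close : ∀ {u w v i} → E₀ u v → E₀ w v → InLevel u i → Close (pow4 i) u w
    co-parents-close (_ , j , ui′ , vj , j<i , uv) (_ , _ , _ , vj′ , _ , wv) ui
      with InLevel-unique ui′ ui | InLevel-unique vj′ vj
    ... | refl | refl = Close-mono (pow4-mono-≤ j<i)
                          (Close-common-neighbour uv wv (<⇒≤ (proj₂ (InLevel-band vj))))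

    lower-co-parent-E₀ : ∀ {u w v i k} → E₀ u v → E₀ w v → InLevel u i → InLevel w k →
                         i <ℕ k → E₀ w u
    lower-co-parent-E₀ uv wv ui wk i<k =
      _ , _ , wk , ui , i<k , Close-sym (co-parents-close uv wv ui)

    in-degree≤1 : ∀ u w v → E u v → E w v → u ≡ w
    in-degree≤1 u w v (uv@(i , _ , ui , _) , u-direct) (wv@(k , _ , wk , _) , w-direct)
      with <-cmp i k
    ... | tri< i<k _ _ = ⊥-elim (w-direct (u , lower-co-parent-E₀ uv wv ui wk i<k , [ uv ]))
    ... | tri≈ _ refl _ = InLevel-close⇒≡ ui wk (co-parents-close uv wv ui)
    ... | tri> _ _ k<i = ⊥-elim (u-direct (w , lower-co-parent-E₀ wv uv wk ui k<i , [ wv ]))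

    isOutForest : IsOutForest InV E
    isOutForest = record
      { edges-in-V = λ { _ _ ((i , j , ui , vj , _) , _) → (i , ui) , (j , vj) }
      ; acyclic    = λ v v⁺v → Descends-irrefl (E⁺⇒Descends v⁺v)
      ; in-deg≤1   = in-degree≤1
      }

mainTheorem10 : (n : ℕ) (d : Fin n → Fin n → ℚ) → IsMetric d →
    (C F : Subset n) → (∀ x → x ∈ C ⊎ x ∈ F) →
    (r : Fin n → ℚ) → (∀ v → v ∈ C → 0ℚ < r v) → (cov : Fin n → ℚ) →
    (rmax : ℚ) → IsMaxOn C r rmax → (t : ℕ) → IsCeilLog4 rmax t →
    (Rs : ℕ → List (Fin n)) →
    (∀ i → 1 ≤ℕ i → i ≤ℕ t →
      Construction.FilterRun d r cov (pow4 i) (Construction.level d r cov C i) (Rs i)) →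
    IsOutForest (Construction.Graph.InV d r cov t Rs) (Construction.Graph.E d r cov t Rs)
-- Neither the positivity of r, the cover X = C ∪ F, the value of t, nor the cov-maximality
-- of the Filter's choices is needed.
mainTheorem10 n d metric C _ _ r _ cov _ _ t _ Rs runs =
  ContactForest.isOutForest d metric r cov C t Rs runs
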